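{- Let $g\ge1$, ${\underline{n}}=(n_1,\dots,n_g),{\underline{r}}=(r_1,\dots,r_g)\in\mathbb{N}_0^g$, and fix any linear order on $P_{{\underline{n}},{\underline{r}}}$. Let $Z=(z_{a,b})$ and $M=(m_{a,b})$ be the square matrices of size $\prod_{i=1}^g(r_i+1)2^{n_i}$, with rows and columns indexed by $P_{{\underline{n}},{\underline{r}}}$ in that order, with entries \[ z_{a,b}=w_{a,b}(\mathbf{Y}),\qquad m_{a,b}=\prod_{i=1}^{g}\Big((-1)^{\Delta_{n_i+1}(a^{(i)},b^{(i)})}\prod_{j=0}^{n_i}Y_{i,j}^{\Delta_j(a^{(i)},b^{(i)})}\Big)\cdot w_{a,b}(\mathbf{Y}^{ -1}) \] for all $a=(a^{(1)},\dots,a^{(g)}),\,b=(b^{(1)},\dots,b^{(g)})\in P_{{\underline{n}},{\underline{r}}}$ with $a^{(i)},b^{(i)}\in P_{n_i,r_i}$. Then $M$ is the inverse of $Z$.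
   Context: $\mathbb{N}_0$ is the set of non-negative integers. $\binom{n}{k}_Y=\prod_{i=1}^{k}\frac{1-Y^{n-k+i}}{1-Y^i}$ for $0\le k\le n$, and $0$ if $k>n$. For $n,r\in\mathbb{N}_0$, $P_{n,r}$ is the set of tuples $a=(a_0,\dots,a_n)$ of non-negative integers with $a_0\le r$, $a_i\le1$ ($1\le i\le n$), ordered by $a\le_t b$ iff $\sum_{j=0}^i a_j\le\sum_{j=0}^i b_j$ for all $i$. Set $s_0(a)=\binom{a_0}{2}$, $s_i(a)=\sum_{k=0}^{i-1}a_k$ ($1\le i\le n+1$), $\Delta_i(a,b)=s_i(b)-s_i(a)$. Define $\theta_{a,b}(Y_0)=\binom{b_0}{a_0}_{Y_0}$; $\phi_{a,b}(Y_1,\dots,Y_n)=\prod_{i\in L_{a,b}}(1-Y_i^{\Delta_i(a,b)})$ if $a\le_t b$ and $0$ otherwise, where $L_{a,b}=\{i\ge1:a_i=1,b_i=0\}$. $P_{{\underline{n}},{\underline{r}}}=P_{n_1,r_1}\times\cdots\times P_{n_g,r_g}$. Variables $\mathbf{Y}=(Y_{i,j})_{i\in[g],0\le j\le n_i}$, and $w_{a,b}(\mathbf{Y})=\prod_{i=1}^g\theta_{a^{(i)},b^{(i)}}(Y_{i,0})\phi_{a^{(i)},b^{(i)}}(Y_{i,1},\dots,Y_{i,n_i})$; $w_{a,b}(\mathbf{Y}^{ -1})$ means substituting $Y_{i,j}^{ -1}$ for each $Y_{i,j}$. Entries lie in the Laurent polynomial ring in $\mathbf{Y}$. -}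

module Defs where

open import Level using (Level; _⊔_)
open import Algebra.Bundles using (CommutativeRing)
open import Data.Nat as ℕ using (ℕ; zero; suc; _≤ᵇ_)
open import Data.Nat.Combinatorics using (_C_)
open import Data.Integer as ℤ using (ℤ; +_; -[1+_]; ∣_∣)
open import Data.Fin using (Fin; zero; suc; toℕ; _≟_)
open import Data.Vec using (Vec; []; _∷_; lookup; toList)
import Data.Vec as Vec
open import Data.List using (List; _∷_; take; upTo)
import Data.Nat.ListAction
open import Data.Bool.ListAction using (all)
import Data.List as List
open import Data.Bool using (Bool; true; false; if_then_else_; _∧_)
open import Data.Product using (_×_; _,_)
open import Data.Unit.Polymorphic using (⊤)
open import Function using (_∘_)
open import Function.Bundles using (_↔_; Inverse)
open import Relation.Nullary.Decidable using (does)

Pnr : ℕ → ℕ → Set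
Pnr n r = Fin (suc r) × Vec (Fin 2) n

entries : ∀ {n r} → Pnr n r → List ℕ
entries (a0 , v) = toℕ a0 ∷ toList (Vec.map toℕ v)

-- s_0(a) = binom(a_0,2),  s_i(a) = a_0 + ... + a_{i-1}  (1 ≤ i ≤ n+1)
s : ∀ {n r} → Pnr n r → ℕ → ℕ
s (a0 , v) zero = toℕ a0 C 2
s a (suc i) = Data.Nat.ListAction.sum (take (suc i) (entries a))

Δ : ∀ {n r} → Pnr n r → Pnr n r → ℕ → ℤ
Δ a b i = (+ s b i) ℤ.- (+ s a i)

leqt : ∀ {n r} → Pnr n r → Pnr n r → Bool
leqt {n} a b = all (λ i → s a (suc i) ≤ᵇ s b (suc i)) (upTo (suc n))

PP : (g : ℕ) → Vec ℕ g → Vec ℕ g → Set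
PP zero [] [] = ⊤
PP (suc g) (n ∷ ns) (r ∷ rs) = Pnr n r × PP g ns rs

size : {g : ℕ} → Vec ℕ g → Vec ℕ g → ℕ
size [] [] = 1
size (n ∷ ns) (r ∷ rs) = (suc r ℕ.* (2 ℕ.^ n)) ℕ.* size ns rs

-- Ring-valued part: variables Y_{i,j} are units of a commutative ring.

module _ {c ℓ : Level} (R : CommutativeRing c ℓ) where
  open CommutativeRing R using (_≈_; _+_; _*_; -_; _-_; 0#; 1#; trans; *-comm) renaming (Carrier to A)

  record UnitV : Set (c ⊔ ℓ) where
    field
      val   : A
      inv   : A
      inv-r : val * inv ≈ 1#
  open UnitV public

  invU : UnitV → UnitV
  invU u = record { val = inv u ; inv = val u
                  ; inv-r = trans (*-comm (inv u) (val u)) (inv-r u) }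

  pow : A → ℕ → A
  pow x zero = 1#
  pow x (suc k) = x * pow x k

  ipow : UnitV → ℤ → A
  ipow u (+ k) = pow (val u) k
  ipow u -[1+ k ] = pow (inv u) (suc k)

  sgn : ℤ → A
  sgn d = pow (- 1#) ∣ d ∣

  gauss : A → ℕ → ℕ → A
  gauss y n zero = 1#
  gauss y zero (suc k) = 0#
  gauss y (suc n) (suc k) = gauss y n k + pow y (suc k) * gauss y n (suc k)

  prodF : ∀ {m} → (Fin m → A) → A
  prodF {zero} f = 1#
  prodF {suc m} f = f zero * prodF (f ∘ suc)

  sumF : ∀ {m} → (Fin m → A) → A
  sumF {zero} f = 0#
  sumF {suc m} f = f zero + sumF (f ∘ suc)

  isOne : Fin 2 → Bool
  isOne x = does (x ≟ suc zero)

  isZero : Fin 2 → Bool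
  isZero x = does (x ≟ zero)

  θ : ∀ {n r} → Pnr n r → Pnr n r → (Fin (suc n) → UnitV) → A
  θ (a0 , _) (b0 , _) Y = gauss (val (Y zero)) (toℕ b0) (toℕ a0)

  φ : ∀ {n r} → Pnr n r → Pnr n r → (Fin (suc n) → UnitV) → A
  φ a@(_ , va) b@(_ , vb) Y =
    if leqt a b
    then prodF (λ i → if isOne (lookup va i) ∧ isZero (lookup vb i)
                      then 1# - ipow (Y (suc i)) (Δ a b (suc (toℕ i)))
                      else 1#)
    else 0#

  w1 : ∀ {n r} → Pnr n r → Pnr n r → (Fin (suc n) → UnitV) → A
  w1 a b Y = θ a b Y * φ a b Y

  m1 : ∀ {n r} → Pnr n r → Pnr n r → (Fin (suc n) → UnitV) → A
  m1 {n} a b Y =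
    (sgn (Δ a b (suc n)) * prodF (λ j → ipow (Y j) (Δ a b (toℕ j))))
      * w1 a b (invU ∘ Y)

  Vars : (g : ℕ) → Vec ℕ g → Set (c ⊔ ℓ)
  Vars g ns = (i : Fin g) → Fin (suc (lookup ns i)) → UnitV

  w : ∀ {g ns rs} → Vars g ns → PP g ns rs → PP g ns rs → A
  w {zero} {[]} {[]} Y _ _ = 1#
  w {suc g} {n ∷ ns} {r ∷ rs} Y (a , as) (b , bs) =
    w1 a b (Y zero) * w (λ i → Y (suc i)) as bs

  m : ∀ {g ns rs} → Vars g ns → PP g ns rs → PP g ns rs → A
  m {zero} {[]} {[]} Y _ _ = 1#
  m {suc g} {n ∷ ns} {r ∷ rs} Y (a , as) (b , bs) =
    m1 a b (Y zero) * m (λ i → Y (suc i)) as bs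

  -- matrices indexed by Fin N via a chosen linear order (enumeration) of P
  Zmat Mmat : ∀ {g ns rs} → (Fin (size ns rs) ↔ PP g ns rs) → Vars g ns
            → Fin (size ns rs) → Fin (size ns rs) → A
  Zmat e Y i j = w Y (Inverse.to e i) (Inverse.to e j)
  Mmat e Y i j = m Y (Inverse.to e i) (Inverse.to e j)

  δ : ∀ {N} → Fin N → Fin N → A
  δ i j = if does (i ≟ j) then 1# else 0#

  matMul : ∀ {N} → (Fin N → Fin N → A) → (Fin N → Fin N → A) → Fin N → Fin N → A
  matMul X Y i j = sumF (λ k → X i k * Y k j)

  IsInverseOf : ∀ {N} → (Fin N → Fin N → A) → (Fin N → Fin N → A) → Set ℓ
  IsInverseOf M X = (∀ i j → matMul X M i j ≈ δ i j) × (∀ i j → matMul M X i j ≈ δ i j)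

{-# OPTIONS --safe #-}
module Submission where

-- Both matrices are Kronecker products over the g blocks, so it suffices to invert a
-- single block P_{n,r}. There w and m split into a part depending only on a₀, b₀ and a
-- product over the positions i of local factors in the bits aᵢ, bᵢ and the running sums
-- sᵢ(a), sᵢ(b). The a₀, b₀ parts are inverse to each other by Gaussian inversion (with the
-- second q-Pascal rule the sums telescope). The local factors see the running sums only
-- through Y^(sᵢ(b) - sᵢ(a)), and Y^(sᵢ(b) - sᵢ(a)) Y^(sᵢ(c) - sᵢ(b)) = Y^(sᵢ(c) - sᵢ(a));
-- hence summing out the bits of the middle index, position by position, leaves a product
-- that does not depend on b₀ and is the identity when a₀ = c₀.

open import Level using (_⊔_)
open import Algebra.Bundles using (CommutativeRing)
import Algebra.Solver.Ring.AlmostCommutativeRing as ACR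
open import Data.Bool using (Bool; true; false; T; if_then_else_; _∧_)
open import Data.Bool.ListAction using (all; and)
open import Data.Empty using (⊥-elim)
open import Data.Fin as Fin using (Fin; zero; suc; toℕ)
import Data.Fin.Properties as Fin
open import Data.Integer as ℤ using (ℤ; +_; -[1+_]; _⊖_)
import Data.Integer.Properties as ℤ
open import Data.List using (upTo; take)
import Data.List.Properties as List
open import Data.Maybe using (Maybe; just; nothing)
open import Data.Nat as ℕ using (ℕ; zero; suc; _<_; _≤_; _≤ᵇ_; s≤s; z≤n)
import Data.Nat.ListAction as ℕ
import Data.Nat.Properties as ℕ
open import Data.Nat.Combinatorics using (_C_; nCk+nC[k+1]≡[n+1]C[k+1]; nC1≡n)
open import Data.Product using (_,_; proj₁; proj₂; uncurry)
open import Data.Product.Properties using (,-injective; ≡-dec)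
import Data.Sign as Sign
open import Data.Sum using (_⊎_; inj₁; inj₂)
open import Data.Unit.Polymorphic using (⊤; tt)
import Data.Unit.Polymorphic.Properties as ⊤
open import Data.Vec as Vec using (Vec; []; _∷_; head; tail; lookup; toList)
open import Function using (_∘_; id)
open import Function.Bundles using (_↔_; Inverse; Injection; mk↔ₛ′; mk⇔)
open import Function.Properties.Inverse using (↔⇒↣; ↔-sym)
open import Relation.Binary.Definitions using (DecidableEquality)
import Relation.Binary.PropositionalEquality as ≡
open ≡ using (_≡_)
open import Relation.Nullary.Decidable using (yes; no; does; _×-dec_; does-⇔; via-injection)

open import Defs hiding (δ)

module IntegerCoefficients {c ℓ} (R : CommutativeRing c ℓ) where
  open CommutativeRing R
  open import Algebra.Properties.Ring ring
    using (-‿distribˡ-*; -‿distribʳ-*; -‿involutive; -0#≈0#; -‿+-comm)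
  open import Algebra.Properties.Semiring.Mult.TCOptimised semiring
    using (_×_; 1+×; ×-homo-+; ×1-homo-*)
  open import Relation.Binary.Reasoning.Setoid setoid

  -- The optimised _×_ makes fromℤ (+ 1) reduce to 1#, so solved equations match
  -- goals written with 1#.
  fromℤ : ℤ → Carrier
  fromℤ (+ n)      = n × 1#
  fromℤ -[1+ n ]   = - (suc n × 1#)

  private
    [x+y]-[x+z]≈y-z : ∀ x y z → (x + y) - (x + z) ≈ y - z
    [x+y]-[x+z]≈y-z x y z = begin
      (x + y) - (x + z)     ≈⟨ +-congˡ (-‿+-comm x z) ⟨
      (x + y) + (- x - z)   ≈⟨ +-assoc x y _ ⟩
      x + (y + (- x - z))   ≈⟨ +-congˡ (+-congˡ (+-comm (- x) (- z))) ⟩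
      x + (y + (- z - x))   ≈⟨ +-congˡ (+-assoc y (- z) (- x)) ⟨
      x + ((y - z) - x)     ≈⟨ +-comm x _ ⟩
      ((y - z) - x) + x     ≈⟨ +-assoc _ (- x) x ⟩
      (y - z) + (- x + x)   ≈⟨ +-congˡ (-‿inverseˡ x) ⟩
      (y - z) + 0#          ≈⟨ +-identityʳ _ ⟩
      y - z                 ∎

  -‿homo : ∀ i → fromℤ (ℤ.- i) ≈ - fromℤ i
  -‿homo -[1+ n ]    = sym (-‿involutive _)
  -‿homo (+ zero)    = sym -0#≈0#
  -‿homo (+ (suc n)) = refl

  ⊖-homo : ∀ m n → fromℤ (m ⊖ n) ≈ m × 1# - n × 1#
  ⊖-homo m       zero    = sym (trans (+-congˡ -0#≈0#) (+-identityʳ _))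
  ⊖-homo zero    (suc n) = sym (+-identityˡ _)
  ⊖-homo (suc m) (suc n) = begin
    fromℤ (suc m ⊖ suc n)            ≡⟨ ≡.cong fromℤ (ℤ.[1+m]⊖[1+n]≡m⊖n m n) ⟩
    fromℤ (m ⊖ n)                    ≈⟨ ⊖-homo m n ⟩
    m × 1# - n × 1#                  ≈⟨ [x+y]-[x+z]≈y-z 1# _ _ ⟨
    (1# + m × 1#) - (1# + n × 1#)    ≈⟨ +-cong (1+× m 1#) (-‿cong (1+× n 1#)) ⟨
    suc m × 1# - suc n × 1#          ∎

  +-homo : ∀ i j → fromℤ (i ℤ.+ j) ≈ fromℤ i + fromℤ j
  +-homo (+ m)    (+ n)    = ×-homo-+ 1# m n
  +-homo (+ m)    -[1+ n ] = ⊖-homo m (suc n)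
  +-homo -[1+ m ] (+ n)    = trans (⊖-homo n (suc m)) (+-comm _ _)
  +-homo -[1+ m ] -[1+ n ] = begin
    - (suc (suc (m ℕ.+ n)) × 1#)      ≡⟨ ≡.cong (λ k → - (k × 1#)) (ℕ.+-suc (suc m) n) ⟨
    - ((suc m ℕ.+ suc n) × 1#)        ≈⟨ -‿cong (×-homo-+ 1# (suc m) (suc n)) ⟩
    - (suc m × 1# + suc n × 1#)       ≈⟨ -‿+-comm _ _ ⟨
    - (suc m × 1#) + - (suc n × 1#)   ∎

  *-homo : ∀ i j → fromℤ (i ℤ.* j) ≈ fromℤ i * fromℤ j
  *-homo (+ m) (+ n) = begin
    fromℤ (Sign.+ ℤ.◃ m ℕ.* n)        ≡⟨ ≡.cong fromℤ (ℤ.+◃n≡+n (m ℕ.* n)) ⟩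
    (m ℕ.* n) × 1#                    ≈⟨ ×1-homo-* m n ⟩
    m × 1# * n × 1#                   ∎
  *-homo (+ m) -[1+ n ] = begin
    fromℤ (Sign.- ℤ.◃ m ℕ.* suc n)    ≡⟨ ≡.cong fromℤ (ℤ.-◃n≡-n (m ℕ.* suc n)) ⟩
    fromℤ (ℤ.- + (m ℕ.* suc n))       ≈⟨ -‿homo (+ (m ℕ.* suc n)) ⟩
    - ((m ℕ.* suc n) × 1#)            ≈⟨ -‿cong (×1-homo-* m (suc n)) ⟩
    - (m × 1# * suc n × 1#)           ≈⟨ -‿distribʳ-* _ _ ⟩
    m × 1# * - (suc n × 1#)           ∎
  *-homo -[1+ m ] (+ n) = begin
    fromℤ (Sign.- ℤ.◃ suc m ℕ.* n)    ≡⟨ ≡.cong fromℤ (ℤ.-◃n≡-n (suc m ℕ.* n)) ⟩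
    fromℤ (ℤ.- + (suc m ℕ.* n))       ≈⟨ -‿homo (+ (suc m ℕ.* n)) ⟩
    - ((suc m ℕ.* n) × 1#)            ≈⟨ -‿cong (×1-homo-* (suc m) n) ⟩
    - (suc m × 1# * n × 1#)           ≈⟨ -‿distribˡ-* _ _ ⟩
    - (suc m × 1#) * n × 1#           ∎
  *-homo -[1+ m ] -[1+ n ] = begin
    (suc m ℕ.* suc n) × 1#            ≈⟨ ×1-homo-* (suc m) (suc n) ⟩
    suc m × 1# * suc n × 1#           ≈⟨ -‿involutive _ ⟨
    - - (suc m × 1# * suc n × 1#)     ≈⟨ -‿cong (-‿distribʳ-* _ _) ⟩
    - (suc m × 1# * - (suc n × 1#))   ≈⟨ -‿distribˡ-* _ _ ⟩
    - (suc m × 1#) * - (suc n × 1#)   ∎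

  homomorphism : ℤ.+-*-rawRing ACR.-Raw-AlmostCommutative⟶ ACR.fromCommutativeRing R
  homomorphism = record
    { ⟦_⟧    = fromℤ
    ; +-homo = +-homo
    ; *-homo = *-homo
    ; -‿homo = -‿homo
    ; 0-homo = refl
    ; 1-homo = refl
    }

  private
    _coeff≟_ : ∀ i j → Maybe (fromℤ i ≈ fromℤ j)
    i coeff≟ j with i ℤ.≟ j
    ... | yes ≡.refl = just refl
    ... | no _       = nothing

  open import Algebra.Solver.Ring ℤ.+-*-rawRing (ACR.fromCommutativeRing R) homomorphism _coeff≟_ public

  :0 :1 :-1 : ∀ {n} → Polynomial n
  :0  = con (+ 0)
  :1  = con (+ 1)
  :-1 = con -[1+ 0 ]

module Kronecker {c ℓ} (R : CommutativeRing c ℓ) where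
  open import Data.Product using (_×_)
  open CommutativeRing R

  𝟙 : Bool → Carrier
  𝟙 b = if b then 1# else 0#

  𝟙-∧ : ∀ a b → 𝟙 (a ∧ b) ≈ 𝟙 a * 𝟙 b
  𝟙-∧ true  b = sym (*-identityˡ _)
  𝟙-∧ false b = sym (zeroˡ _)

  -- δ[ _≟_ ] does not depend on the decision procedure (does-⇔), which is why the
  -- lemmas below may use unrelated procedures on the two sides.
  δ[_] : {X : Set} → DecidableEquality X → X → X → Carrier
  δ[ _≟_ ] x y = 𝟙 (does (x ≟ y))

  module _ {X : Set} (_≟_ : DecidableEquality X) where

    δ-sym : ∀ x y → δ[ _≟_ ] x y ≈ δ[ _≟_ ] y x
    δ-sym x y = reflexive (≡.cong 𝟙 (does-⇔ (mk⇔ ≡.sym ≡.sym) (x ≟ y) (y ≟ x)))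

    δ-subst : ∀ x y (f : X → Carrier) → δ[ _≟_ ] x y * f x ≈ δ[ _≟_ ] x y * f y
    δ-subst x y f with x ≟ y
    ... | yes ≡.refl = refl
    ... | no _       = trans (zeroˡ _) (sym (zeroˡ _))

    δ-injective : ∀ {Y : Set} (_≟′_ : DecidableEquality Y) {f : X → Y} →
                  (∀ {x y} → f x ≡ f y → x ≡ y) →
                  ∀ x y → δ[ _≟′_ ] (f x) (f y) ≈ δ[ _≟_ ] x y
    δ-injective _≟′_ {f} f-inj x y =
      reflexive (≡.cong 𝟙 (does-⇔ (mk⇔ f-inj (≡.cong f)) (f x ≟′ f y) (x ≟ y)))

    δ-× : ∀ {Y : Set} (_≟′_ : DecidableEquality Y) (_≟″_ : DecidableEquality (X × Y)) →
          ∀ x x′ y y′ → δ[ _≟″_ ] (x , y) (x′ , y′) ≈ δ[ _≟_ ] x x′ * δ[ _≟′_ ] y y′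
    δ-× _≟′_ _≟″_ x x′ y y′ = begin
      𝟙 (does ((x , y) ≟″ (x′ , y′)))        ≈⟨ reflexive (≡.cong 𝟙 componentwise) ⟩
      𝟙 (does ((x ≟ x′) ×-dec (y ≟′ y′)))    ≈⟨ 𝟙-∧ _ _ ⟩
      δ[ _≟_ ] x x′ * δ[ _≟′_ ] y y′        ∎
      where
      open import Relation.Binary.Reasoning.Setoid setoid
      componentwise : does ((x , y) ≟″ (x′ , y′)) ≡ does ((x ≟ x′) ×-dec (y ≟′ y′))
      componentwise = does-⇔ (mk⇔ ,-injective (uncurry (≡.cong₂ _,_))) ((x , y) ≟″ (x′ , y′)) ((x ≟ x′) ×-dec (y ≟′ y′))

module FiniteSums {c ℓ} (R : CommutativeRing c ℓ) where
  open import Data.Product using (_×_)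
  open CommutativeRing R hiding (zero)
  open Kronecker R
  open import Algebra.Properties.CommutativeSemigroup +-commutativeSemigroup
    using () renaming (interchange to +-interchange)
  open import Algebra.Properties.CommutativeSemigroup *-commutativeSemigroup
    using () renaming (interchange to *-interchange)
  open import Relation.Binary.Reasoning.Setoid setoid

  record Summation (X : Set) : Set (c ⊔ ℓ) where
    field
      ∑            : (X → Carrier) → Carrier
      ∑-cong       : ∀ {f g} → (∀ x → f x ≈ g x) → ∑ f ≈ ∑ g
      ∑-distrib-+  : ∀ f g → ∑ (λ x → f x + g x) ≈ ∑ f + ∑ g
      ∑-distribˡ-* : ∀ k f → ∑ (λ x → k * f x) ≈ k * ∑ f
      _≟_          : DecidableEquality X
      ∑-δ          : ∀ y (f : X → Carrier) → ∑ (λ x → δ[ _≟_ ] x y * f x) ≈ f y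

    δ : X → X → Carrier
    δ = δ[ _≟_ ]

    ∑-distribʳ-* : ∀ k f → ∑ (λ x → f x * k) ≈ ∑ f * k
    ∑-distribʳ-* k f = begin
      ∑ (λ x → f x * k)  ≈⟨ ∑-cong (λ x → *-comm (f x) k) ⟩
      ∑ (λ x → k * f x)  ≈⟨ ∑-distribˡ-* k f ⟩
      k * ∑ f            ≈⟨ *-comm k _ ⟩
      ∑ f * k            ∎

    ∑-0 : ∑ (λ _ → 0#) ≈ 0#
    ∑-0 = begin
      ∑ (λ _ → 0#)       ≈⟨ ∑-cong (λ _ → zeroˡ 0#) ⟨
      ∑ (λ _ → 0# * 0#)  ≈⟨ ∑-distribˡ-* 0# (λ _ → 0#) ⟩
      0# * ∑ (λ _ → 0#)  ≈⟨ zeroˡ _ ⟩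
      0#                 ∎

    _⊙_ : (X → X → Carrier) → (X → X → Carrier) → X → X → Carrier
    (P ⊙ Q) a c = ∑ (λ b → P a b * Q b c)

    IsRightInverseOf : (X → X → Carrier) → (X → X → Carrier) → Set ℓ
    IsRightInverseOf Q P = ∀ a c → (P ⊙ Q) a c ≈ δ a c

  open Summation public

  sumF-cong : ∀ {m} {f g : Fin m → Carrier} → (∀ x → f x ≈ g x) → sumF R f ≈ sumF R g
  sumF-cong {zero}  f≈g = refl
  sumF-cong {suc m} f≈g = +-cong (f≈g zero) (sumF-cong (f≈g ∘ suc))

  sumF-distrib-+ : ∀ {m} (f g : Fin m → Carrier) → sumF R (λ x → f x + g x) ≈ sumF R f + sumF R g
  sumF-distrib-+ {zero}  f g = sym (+-identityˡ 0#)
  sumF-distrib-+ {suc m} f g =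
    trans (+-congˡ (sumF-distrib-+ (f ∘ suc) (g ∘ suc))) (+-interchange _ _ _ _)

  sumF-distribˡ-* : ∀ {m} k (f : Fin m → Carrier) → sumF R (λ x → k * f x) ≈ k * sumF R f
  sumF-distribˡ-* {zero}  k f = sym (zeroʳ k)
  sumF-distribˡ-* {suc m} k f = trans (+-congˡ (sumF-distribˡ-* k (f ∘ suc))) (sym (distribˡ _ _ _))

  sumF-δ : ∀ {m} (y : Fin m) (f : Fin m → Carrier) → sumF R (λ x → δ[ Fin._≟_ ] x y * f x) ≈ f y
  sumF-δ zero f = begin
    1# * f zero + sumF R (λ x → 0# * f (suc x))  ≈⟨ +-cong (*-identityˡ _) (sumF-distribˡ-* 0# (f ∘ suc)) ⟩
    f zero + 0# * sumF R (f ∘ suc)               ≈⟨ +-congˡ (zeroˡ _) ⟩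
    f zero + 0#                                  ≈⟨ +-identityʳ _ ⟩
    f zero                                       ∎
  sumF-δ (suc y) f = begin
    0# * f zero + sumF R (λ x → δ[ Fin._≟_ ] x y * f (suc x))  ≈⟨ +-cong (zeroˡ _) (sumF-δ y (f ∘ suc)) ⟩
    0# + f (suc y)                                             ≈⟨ +-identityˡ _ ⟩
    f (suc y)                                                  ∎

  Fin-summation : ∀ m → Summation (Fin m)
  Fin-summation m = record
    { ∑            = sumF R
    ; ∑-cong       = sumF-cong
    ; ∑-distrib-+  = sumF-distrib-+
    ; ∑-distribˡ-* = sumF-distribˡ-*
    ; _≟_          = Fin._≟_
    ; ∑-δ          = sumF-δ
    }

  ⊤-summation : Summation ⊤
  ⊤-summation = record
    { ∑            = λ f → f tt
    ; ∑-cong       = λ f≈g → f≈g tt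
    ; ∑-distrib-+  = λ _ _ → refl
    ; ∑-distribˡ-* = λ _ _ → refl
    ; _≟_          = ⊤._≟_
    ; ∑-δ          = λ _ f → *-identityˡ (f tt)
    }

  ×-summation : ∀ {X Y} → Summation X → Summation Y → Summation (X × Y)
  ×-summation {X} {Y} SX SY = record
    { ∑            = ∑²
    ; ∑-cong       = λ f≈g → ∑-cong SX (λ x → ∑-cong SY (λ y → f≈g (x , y)))
    ; ∑-distrib-+  = λ f g → trans (∑-cong SX (λ x → ∑-distrib-+ SY _ _)) (∑-distrib-+ SX _ _)
    ; ∑-distribˡ-* = λ k f → trans (∑-cong SX (λ x → ∑-distribˡ-* SY _ _)) (∑-distribˡ-* SX _ _)
    ; _≟_          = _≟²_
    ; ∑-δ          = sift
    }
    where
    ∑² : (X × Y → Carrier) → Carrier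
    ∑² f = ∑ SX (λ x → ∑ SY (λ y → f (x , y)))
    _≟²_ : DecidableEquality (X × Y)
    _≟²_ = ≡-dec (_≟_ SX) (_≟_ SY)
    sift : ∀ p f → ∑² (λ q → δ[ _≟²_ ] q p * f q) ≈ f p
    sift (x′ , y′) f = begin
      ∑² (λ q → δ[ _≟²_ ] q (x′ , y′) * f q)
        ≈⟨ ∑-cong SX (λ x → ∑-cong SY (λ y → *-congʳ (δ-× (_≟_ SX) (_≟_ SY) _≟²_ x x′ y y′))) ⟩
      ∑ SX (λ x → ∑ SY (λ y → (δ SX x x′ * δ SY y y′) * f (x , y)))
        ≈⟨ ∑-cong SX (λ x → trans (∑-cong SY (λ y → *-assoc _ _ _)) (∑-distribˡ-* SY _ _)) ⟩
      ∑ SX (λ x → δ SX x x′ * ∑ SY (λ y → δ SY y y′ * f (x , y)))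
        ≈⟨ ∑-cong SX (λ x → *-congˡ (∑-δ SY y′ (λ y → f (x , y)))) ⟩
      ∑ SX (λ x → δ SX x x′ * f (x , y′))
        ≈⟨ ∑-δ SX x′ (λ x → f (x , y′)) ⟩
      f (x′ , y′) ∎

  ↔-summation : ∀ {X Z} → Summation X → Z ↔ X → Summation Z
  ↔-summation {X} {Z} SX e = record
    { ∑            = λ f → ∑ SX (f ∘ from)
    ; ∑-cong       = λ f≈g → ∑-cong SX (f≈g ∘ from)
    ; ∑-distrib-+  = λ f g → ∑-distrib-+ SX (f ∘ from) (g ∘ from)
    ; ∑-distribˡ-* = λ k f → ∑-distribˡ-* SX k (f ∘ from)
    ; _≟_          = _≟ᶻ_
    ; ∑-δ          = sift
    }
    where
    open Inverse e
    _≟ᶻ_ : DecidableEquality Z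
    _≟ᶻ_ = via-injection (↔⇒↣ e) (_≟_ SX)
    sift : ∀ z f → ∑ SX (λ x → δ[ _≟ᶻ_ ] (from x) z * f (from x)) ≈ f z
    sift z f = begin
      ∑ SX (λ x → δ[ _≟ᶻ_ ] (from x) z * f (from x))
        ≈⟨ ∑-cong SX (λ x → *-congʳ (reflexive (≡.cong (δ[ _≟ᶻ_ ] (from x)) (≡.sym (strictlyInverseʳ z))))) ⟩
      ∑ SX (λ x → δ[ _≟ᶻ_ ] (from x) (from (to z)) * f (from x))
        ≈⟨ ∑-cong SX (λ x → *-congʳ (δ-injective (_≟_ SX) _≟ᶻ_ (Injection.injective (↔⇒↣ (↔-sym e))) x (to z))) ⟩
      ∑ SX (λ x → δ SX x (to z) * f (from x))
        ≈⟨ ∑-δ SX (to z) (f ∘ from) ⟩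
      f (from (to z))
        ≡⟨ ≡.cong f (strictlyInverseʳ z) ⟩
      f z ∎

  Vec-summation : ∀ {A} → Summation A → ∀ n → Summation (Vec A n)
  Vec-summation SA zero    = ↔-summation ⊤-summation
    (mk↔ₛ′ (λ _ → tt) (λ _ → []) (λ _ → ≡.refl) λ { [] → ≡.refl })
  Vec-summation SA (suc n) = ↔-summation (×-summation SA (Vec-summation SA n))
    (mk↔ₛ′ (λ v → head v , tail v) (uncurry _∷_) (λ _ → ≡.refl) λ { (x ∷ v) → ≡.refl })

  IsRightInverseOf-resp : ∀ {X} (S : Summation X) {P P′ Q Q′ : X → X → Carrier} →
                          (∀ a b → P a b ≈ P′ a b) → (∀ a b → Q a b ≈ Q′ a b) →
                          IsRightInverseOf S Q P → IsRightInverseOf S Q′ P′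
  IsRightInverseOf-resp S P≈P′ Q≈Q′ PQ≈δ a c =
    trans (∑-cong S (λ b → *-cong (sym (P≈P′ a b)) (sym (Q≈Q′ b c)))) (PQ≈δ a c)

  _⊗_ : ∀ {X Y : Set} → (X → X → Carrier) → (Y → Y → Carrier) → X × Y → X × Y → Carrier
  (P ⊗ Q) (a , b) (a′ , b′) = P a a′ * Q b b′

  ⊗-rightInverse : ∀ {X Y} (SX : Summation X) (SY : Summation Y) {P Q P′ Q′} →
                   IsRightInverseOf SX Q P → IsRightInverseOf SY Q′ P′ →
                   IsRightInverseOf (×-summation SX SY) (Q ⊗ Q′) (P ⊗ P′)
  ⊗-rightInverse SX SY {P} {Q} {P′} {Q′} PQ≈δ P′Q′≈δ (a , a′) (c , c′) = begin
    ∑ SX (λ b → ∑ SY (λ b′ → (P a b * P′ a′ b′) * (Q b c * Q′ b′ c′)))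
      ≈⟨ ∑-cong SX (λ b → ∑-cong SY (λ b′ → *-interchange _ _ _ _)) ⟩
    ∑ SX (λ b → ∑ SY (λ b′ → (P a b * Q b c) * (P′ a′ b′ * Q′ b′ c′)))
      ≈⟨ ∑-cong SX (λ b → ∑-distribˡ-* SY _ _) ⟩
    ∑ SX (λ b → (P a b * Q b c) * ∑ SY (λ b′ → P′ a′ b′ * Q′ b′ c′))
      ≈⟨ ∑-distribʳ-* SX _ _ ⟩
    ∑ SX (λ b → P a b * Q b c) * ∑ SY (λ b′ → P′ a′ b′ * Q′ b′ c′)
      ≈⟨ *-cong (PQ≈δ a c) (P′Q′≈δ a′ c′) ⟩
    δ SX a c * δ SY a′ c′
      ≈⟨ δ-× (_≟_ SX) (_≟_ SY) (_≟_ (×-summation SX SY)) a c a′ c′ ⟨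
    δ (×-summation SX SY) (a , a′) (c , c′) ∎

  sumF-∑-comm : ∀ {X} (S : Summation X) {m} (G : Fin m → X → Carrier) →
                sumF R (λ k → ∑ S (G k)) ≈ ∑ S (λ x → sumF R (λ k → G k x))
  sumF-∑-comm S {zero}  G = sym (∑-0 S)
  sumF-∑-comm S {suc m} G = trans (+-congˡ (sumF-∑-comm S (G ∘ suc))) (sym (∑-distrib-+ S _ _))

  module _ {X : Set} {N : ℕ} (S : Summation X) (e : Fin N ↔ X) where
    open Inverse e

    private
      δ-to : ∀ i j → δ S (to i) (to j) ≈ δ[ Fin._≟_ ] i j
      δ-to = δ-injective Fin._≟_ (_≟_ S) (Injection.injective (↔⇒↣ e))

    ∑-reindex : ∀ F → sumF R (F ∘ to) ≈ ∑ S F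
    ∑-reindex F = begin
      sumF R (F ∘ to)                                       ≈⟨ sumF-cong (λ k → ∑-δ S (to k) F) ⟨
      sumF R (λ k → ∑ S (λ p → δ S p (to k) * F p))         ≈⟨ sumF-∑-comm S (λ k p → δ S p (to k) * F p) ⟩
      ∑ S (λ p → sumF R (λ k → δ S p (to k) * F p))         ≈⟨ ∑-cong S (λ p → sumF-cong (λ k → *-congʳ (δ-from p k))) ⟩
      ∑ S (λ p → sumF R (λ k → δ[ Fin._≟_ ] k (from p) * F p)) ≈⟨ ∑-cong S (λ p → sumF-δ (from p) (λ _ → F p)) ⟩
      ∑ S F                                                 ∎
      where
      δ-from : ∀ p k → δ S p (to k) ≈ δ[ Fin._≟_ ] k (from p)
      δ-from p k = begin
        δ S p (to k)                ≡⟨ ≡.cong (λ q → δ S q (to k)) (strictlyInverseˡ p) ⟨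
        δ S (to (from p)) (to k)    ≈⟨ δ-to (from p) k ⟩
        δ[ Fin._≟_ ] (from p) k     ≈⟨ δ-sym Fin._≟_ (from p) k ⟩
        δ[ Fin._≟_ ] k (from p)     ∎

    reindex-rightInverse : ∀ {P Q} → IsRightInverseOf S Q P →
                           IsRightInverseOf (Fin-summation N) (λ i j → Q (to i) (to j)) (λ i j → P (to i) (to j))
    reindex-rightInverse {P} {Q} PQ≈δ i j = begin
      sumF R (λ k → P (to i) (to k) * Q (to k) (to j))  ≈⟨ ∑-reindex (λ p → P (to i) p * Q p (to j)) ⟩
      ∑ S (λ p → P (to i) p * Q p (to j))               ≈⟨ PQ≈δ (to i) (to j) ⟩
      δ S (to i) (to j)                                 ≈⟨ δ-to i j ⟩
      δ[ Fin._≟_ ] i j                                  ∎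

module Powers {c ℓ} (R : CommutativeRing c ℓ) where
  open CommutativeRing R hiding (zero)
  open IntegerCoefficients R using (solve; _:=_; _:+_; _:*_; _:-_; :-_; :0; :1; :-1)
  open import Algebra.Properties.CommutativeSemigroup *-commutativeSemigroup
    using () renaming (interchange to *-interchange)
  open import Relation.Binary.Reasoning.Setoid setoid

  pow-+ : ∀ x m n → pow R x (m ℕ.+ n) ≈ pow R x m * pow R x n
  pow-+ x zero    n = sym (*-identityˡ _)
  pow-+ x (suc m) n = trans (*-congˡ (pow-+ x m n)) (sym (*-assoc _ _ _))

  pow-inverse : ∀ {x y} → x * y ≈ 1# → ∀ k → pow R x k * pow R y k ≈ 1#
  pow-inverse xy≈1 zero    = *-identityˡ 1#
  pow-inverse xy≈1 (suc k) = trans (*-interchange _ _ _ _) (trans (*-cong xy≈1 (pow-inverse xy≈1 k)) (*-identityˡ 1#))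

  -1ᵘ : UnitV R
  -1ᵘ = record { val = - 1# ; inv = - 1# ; inv-r = solve 0 (:-1 :* :-1 := :1) refl }

  σ : ℕ → Carrier
  σ = pow R (- 1#)

  σ-involutive : ∀ k → σ k * σ k ≈ 1#
  σ-involutive = pow-inverse (inv-r -1ᵘ)

  module _ (q : UnitV R) where
    private
      v i : Carrier
      v = val q
      i = inv q

    ratio : ℕ → ℕ → Carrier
    ratio m n = pow R v n * pow R i m

    ratio-refl : ∀ m → ratio m m ≈ 1#
    ratio-refl = pow-inverse (inv-r q)

    ratio-trans : ∀ l m n → ratio l m * ratio m n ≈ ratio l n
    ratio-trans l m n = begin
      (pow R v m * pow R i l) * (pow R v n * pow R i m)   ≈⟨ solve 4 (λ a b c d → (a :* b) :* (c :* d) := (c :* b) :* (a :* d)) refl _ _ _ _ ⟩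
      (pow R v n * pow R i l) * (pow R v m * pow R i m)   ≈⟨ *-congˡ (ratio-refl m) ⟩
      (pow R v n * pow R i l) * 1#                        ≈⟨ *-identityʳ _ ⟩
      pow R v n * pow R i l                               ∎

    ipow-⊖ : ∀ m n → ipow R q (m ⊖ n) ≈ ratio n m
    ipow-⊖ m       zero    = sym (*-identityʳ _)
    ipow-⊖ zero    (suc n) = sym (*-identityˡ _)
    ipow-⊖ (suc m) (suc n) = begin
      ipow R q (suc m ⊖ suc n)            ≡⟨ ≡.cong (ipow R q) (ℤ.[1+m]⊖[1+n]≡m⊖n m n) ⟩
      ipow R q (m ⊖ n)                    ≈⟨ ipow-⊖ m n ⟩
      pow R v m * pow R i n               ≈⟨ *-identityˡ _ ⟨
      1# * (pow R v m * pow R i n)        ≈⟨ *-congʳ (inv-r q) ⟨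
      (v * i) * (pow R v m * pow R i n)   ≈⟨ *-interchange _ _ _ _ ⟩
      (v * pow R v m) * (i * pow R i n)   ∎

    ipow-ratio : ∀ m n → ipow R q (+ n ℤ.- + m) ≈ ratio m n
    ipow-ratio m n = trans (reflexive (≡.cong (ipow R q) (ℤ.[+m]-[+n]≡m⊖n n m))) (ipow-⊖ n m)

module GaussianInversion {c ℓ} (R : CommutativeRing c ℓ) where
  open CommutativeRing R hiding (zero)
  open IntegerCoefficients R using (solve; _:=_; _:+_; _:*_; _:-_; :-_; :0; :1; :-1)
  open Kronecker R
  open FiniteSums R
  open Powers R
  open import Relation.Binary.Reasoning.Setoid setoid

  gauss-vanishes : ∀ y {n k} → n < k → gauss R y n k ≈ 0#
  gauss-vanishes y {zero}  {suc k} _         = refl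
  gauss-vanishes y {suc n} {suc k} (s≤s n<k) = begin
    gauss R y n k + pow R y (suc k) * gauss R y n (suc k)
      ≈⟨ +-cong (gauss-vanishes y n<k) (*-congˡ (gauss-vanishes y (ℕ.m<n⇒m<1+n n<k))) ⟩
    0# + pow R y (suc k) * 0#
      ≈⟨ solve 1 (λ p → :0 :+ p :* :0 := :0) refl _ ⟩
    0# ∎

  gauss-pascal′ : ∀ y b k →
                  pow R y k * gauss R y (suc b) (suc k) ≈ pow R y b * gauss R y b k + pow R y k * gauss R y b (suc k)
  gauss-pascal′ y zero    zero    = solve 1 (λ y → :1 :* (:1 :+ (y :* :1) :* :0) := :1 :* :1 :+ :1 :* :0) refl y
  gauss-pascal′ y zero    (suc k) = solve 2 (λ p p′ → p :* (:0 :+ p′ :* :0) := :1 :* :0 :+ p :* :0) refl _ _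
  gauss-pascal′ y (suc b) zero    = begin
    1# * (1# + (y * 1#) * g)
      ≈⟨ solve 2 (λ y g → :1 :* (:1 :+ (y :* :1) :* g) := :1 :+ y :* (:1 :* g)) refl y g ⟩
    1# + y * (1# * g)
      ≈⟨ +-congˡ (*-congˡ (gauss-pascal′ y b zero)) ⟩
    1# + y * (pow R y b * 1# + 1# * gauss R y b 1)
      ≈⟨ solve 3 (λ y p g → :1 :+ y :* (p :* :1 :+ :1 :* g) := (y :* p) :* :1 :+ :1 :* (:1 :+ (y :* :1) :* g))
                 refl y (pow R y b) (gauss R y b 1) ⟩
    pow R y (suc b) * 1# + 1# * g ∎
    where g = gauss R y (suc b) 1
  gauss-pascal′ y (suc b) (suc k) = begin
    pow R y (suc k) * (gauss R y (suc b) (suc k) + pow R y (suc (suc k)) * gauss R y (suc b) (suc (suc k)))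
      ≈⟨ solve 4 (λ y p g g′ → (y :* p) :* (g :+ (y :* (y :* p)) :* g′) := y :* (p :* g) :+ (y :* (y :* p)) :* ((y :* p) :* g′))
                 refl y (pow R y k) _ _ ⟩
    y * (pow R y k * gauss R y (suc b) (suc k)) + pow R y (suc (suc k)) * (pow R y (suc k) * gauss R y (suc b) (suc (suc k)))
      ≈⟨ +-cong (*-congˡ (gauss-pascal′ y b k)) (*-congˡ (gauss-pascal′ y b (suc k))) ⟩
    y * (pow R y b * g₀ + pow R y k * g₁) + pow R y (suc (suc k)) * (pow R y b * g₁ + pow R y (suc k) * g₂)
      ≈⟨ solve 6 (λ y p p′ g₀ g₁ g₂ →
           y :* (p′ :* g₀ :+ p :* g₁) :+ (y :* (y :* p)) :* (p′ :* g₁ :+ (y :* p) :* g₂)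
           := (y :* p′) :* (g₀ :+ (y :* p) :* g₁) :+ (y :* p) :* (g₁ :+ (y :* (y :* p)) :* g₂))
         refl y (pow R y k) (pow R y b) g₀ g₁ g₂ ⟩
    pow R y (suc b) * gauss R y (suc b) (suc k) + pow R y (suc k) * gauss R y (suc b) (suc (suc k)) ∎
    where
    g₀ = gauss R y b k
    g₁ = gauss R y b (suc k)
    g₂ = gauss R y b (suc (suc k))

  sumF-telescoping : ∀ {M} (h : ℕ → Carrier) → sumF R {M} (λ b → h (toℕ b) - h (suc (toℕ b))) ≈ h 0 - h M
  sumF-telescoping {zero}  h = sym (-‿inverseʳ (h 0))
  sumF-telescoping {suc M} h = trans (+-congˡ (sumF-telescoping (h ∘ suc)))
    (solve 3 (λ x y z → (x :- y) :+ (y :- z) := x :- z) refl (h 0) (h 1) (h (suc M)))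

  module _ (q : UnitV R) where
    private
      v i : Carrier
      v = val q
      i = inv q
      G : ℕ → ℕ → Carrier
      G = gauss R v

    gauss-difference : ∀ b k → pow R i b * G (suc b) (suc k) - pow R i b * G b (suc k) ≈ pow R i k * G b k
    gauss-difference b k = begin
      iᵇ * G (suc b) (suc k) - iᵇ * G b (suc k)
        ≈⟨ trans (*-congˡ (ratio-refl q k)) (*-identityʳ _) ⟨
      (iᵇ * G (suc b) (suc k) - iᵇ * G b (suc k)) * (vᵏ * iᵏ)
        ≈⟨ solve 5 (λ iᵇ iᵏ vᵏ g g′ → (iᵇ :* g :- iᵇ :* g′) :* (vᵏ :* iᵏ) := (iᵇ :* iᵏ) :* (vᵏ :* g :- vᵏ :* g′)) refl iᵇ iᵏ vᵏ _ _ ⟩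
      (iᵇ * iᵏ) * (vᵏ * G (suc b) (suc k) - vᵏ * G b (suc k))
        ≈⟨ *-congˡ (+-congʳ (gauss-pascal′ v b k)) ⟩
      (iᵇ * iᵏ) * ((pow R v b * G b k + vᵏ * G b (suc k)) - vᵏ * G b (suc k))
        ≈⟨ solve 5 (λ iᵇ iᵏ vᵇ g x → (iᵇ :* iᵏ) :* ((vᵇ :* g :+ x) :- x) := (iᵏ :* g) :* (vᵇ :* iᵇ)) refl iᵇ iᵏ (pow R v b) _ _ ⟩
      (iᵏ * G b k) * (pow R v b * iᵇ)
        ≈⟨ trans (*-congˡ (ratio-refl q b)) (*-identityʳ _) ⟩
      iᵏ * G b k ∎
      where
      iᵇ = pow R i b
      iᵏ = pow R i k
      vᵏ = pow R v k

    -- The a₀, b₀ part of m₁: (-1)^(a+b) q^(C(b,2) - C(a,2)) [b choose a] at q⁻¹.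
    invGauss : ℕ → ℕ → Carrier
    invGauss a b = (σ a * σ b) * ratio q (a C 2) (b C 2) * gauss R i b a

    private
      C-suc : ∀ n → suc n C 2 ≡ n C 2 ℕ.+ n
      C-suc n = ≡.trans (≡.sym (nCk+nC[k+1]≡[n+1]C[k+1] n 1)) (≡.trans (≡.cong (ℕ._+ n C 2) (nC1≡n n)) (ℕ.+-comm n (n C 2)))

      pow-C-suc : ∀ x n → pow R x (suc n C 2) ≈ pow R x (n C 2) * pow R x n
      pow-C-suc x n = trans (reflexive (≡.cong (pow R x) (C-suc n))) (pow-+ x (n C 2) n)

    invGauss-vanishes : ∀ {b c} → c < b → invGauss b c ≈ 0#
    invGauss-vanishes c<b = trans (*-congˡ (gauss-vanishes i c<b)) (zeroʳ _)

    invGauss-zero-suc : ∀ c → invGauss 0 (suc c) ≈ - (pow R v c * invGauss 0 c)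
    invGauss-zero-suc c = begin
      (1# * (- 1# * σ c)) * (pow R v (suc c C 2) * 1#) * 1#     ≈⟨ *-congʳ (*-congˡ (*-congʳ (pow-C-suc v c))) ⟩
      (1# * (- 1# * σ c)) * ((pow R v (c C 2) * pow R v c) * 1#) * 1#
        ≈⟨ solve 3 (λ s V W → (:1 :* (:-1 :* s)) :* ((V :* W) :* :1) :* :1
                     := :- (W :* ((:1 :* s) :* (V :* :1) :* :1))) refl (σ c) _ _ ⟩
      - (pow R v c * invGauss 0 c)                               ∎

    invGauss-suc-suc : ∀ b c → invGauss (suc b) (suc c)
                                 ≈ pow R v c * pow R i b * invGauss b c - pow R v c * pow R i (suc b) * invGauss (suc b) c
    invGauss-suc-suc b c = begin
      ((- 1# * σ b) * (- 1# * σ c)) * (pow R v (suc c C 2) * pow R i (suc b C 2)) * (g + (i * iᵇ) * g′)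
        ≈⟨ *-congʳ (*-congˡ (*-cong (pow-C-suc v c) (pow-C-suc i b))) ⟩
      ((- 1# * σ b) * (- 1# * σ c)) * ((V * vᶜ) * (I * iᵇ)) * (g + (i * iᵇ) * g′)
        ≈⟨ solve 9 (λ sb sc V vᶜ I iᵇ i g g′ →
             ((:-1 :* sb) :* (:-1 :* sc)) :* ((V :* vᶜ) :* (I :* iᵇ)) :* (g :+ (i :* iᵇ) :* g′)
             := vᶜ :* iᵇ :* ((sb :* sc) :* (V :* I) :* g) :- vᶜ :* (i :* iᵇ) :* (((:-1 :* sb) :* sc) :* (V :* (I :* iᵇ)) :* g′))
           refl (σ b) (σ c) V vᶜ I iᵇ i g g′ ⟩
      vᶜ * iᵇ * invGauss b c - vᶜ * (i * iᵇ) * (((- 1# * σ b) * σ c) * (V * (I * iᵇ)) * g′)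
        ≈⟨ +-congˡ (-‿cong (*-congˡ (*-congʳ (*-congˡ (*-congˡ (pow-C-suc i b)))))) ⟨
      vᶜ * iᵇ * invGauss b c - vᶜ * (i * iᵇ) * invGauss (suc b) c ∎
      where
      V = pow R v (c C 2)
      vᶜ = pow R v c
      I = pow R i (b C 2)
      iᵇ = pow R i b
      g = gauss R i c b
      g′ = gauss R i c (suc b)

    private
      ∑-gauss-invGauss-suc : ∀ M a c →
        sumF R {suc M} (λ b → G (toℕ b) a * invGauss (toℕ b) (suc c))
          ≈ pow R v c * (sumF R {M} (λ b → (pow R i (toℕ b) * G (suc (toℕ b)) a - pow R i (toℕ b) * G (toℕ b) a) * invGauss (toℕ b) c)
                         - pow R i M * G M a * invGauss M c)
      ∑-gauss-invGauss-suc M a c = begin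
        G 0 a * invGauss 0 (suc c) + sumF R {M} (λ b → G (suc (toℕ b)) a * invGauss (suc (toℕ b)) (suc c))
          ≈⟨ +-cong (*-congˡ (invGauss-zero-suc c)) (sumF-cong {M} (λ b → step (toℕ b))) ⟩
        G 0 a * - (vᶜ * invGauss 0 c) + sumF R {M} (λ b → vᶜ * (D (toℕ b) + (h (toℕ b) - h (suc (toℕ b)))))
          ≈⟨ +-congˡ (trans (sumF-distribˡ-* {M} vᶜ _) (*-congˡ (sumF-distrib-+ {M} _ _))) ⟩
        G 0 a * - (vᶜ * invGauss 0 c) + vᶜ * (ΣD + sumF R {M} (λ b → h (toℕ b) - h (suc (toℕ b))))
          ≈⟨ +-congˡ (*-congˡ (+-congˡ (sumF-telescoping {M} h))) ⟩
        G 0 a * - (vᶜ * invGauss 0 c) + vᶜ * (ΣD + (h 0 - h M))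
          ≈⟨ solve 5 (λ g vᶜ t x y → g :* :- (vᶜ :* t) :+ vᶜ :* (x :+ (:1 :* g :* t :- y)) := vᶜ :* (x :- y))
               refl (G 0 a) vᶜ (invGauss 0 c) ΣD (h M) ⟩
        vᶜ * (ΣD - h M) ∎
        where
        vᶜ = pow R v c
        h : ℕ → Carrier
        h b = pow R i b * G b a * invGauss b c
        D : ℕ → Carrier
        D b = (pow R i b * G (suc b) a - pow R i b * G b a) * invGauss b c
        ΣD = sumF R {M} (λ b → D (toℕ b))
        step : ∀ b → G (suc b) a * invGauss (suc b) (suc c) ≈ vᶜ * (D b + (h b - h (suc b)))
        step b = trans (*-congˡ (invGauss-suc-suc b c))
          (solve 7 (λ vᶜ iᵇ i g₁ g₀ t₀ t₁ →
                g₁ :* (vᶜ :* iᵇ :* t₀ :- vᶜ :* (i :* iᵇ) :* t₁)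
             := vᶜ :* ((iᵇ :* g₁ :- iᵇ :* g₀) :* t₀ :+ (iᵇ :* g₀ :* t₀ :- (i :* iᵇ) :* g₁ :* t₁)))
           refl vᶜ (pow R i b) i (G (suc b) a) (G b a) (invGauss b c) (invGauss (suc b) c))

    -- Induction on c: by invGauss-suc-suc the sum for c + 1 telescopes, and with
    -- gauss-difference it becomes q^c q^(-a′) times the sum for a′, c (where a = a′ + 1).
    ∑-gauss-invGauss : ∀ M a c → c < M → sumF R {M} (λ b → G (toℕ b) a * invGauss (toℕ b) c) ≈ δ[ ℕ._≟_ ] a c
    ∑-gauss-invGauss (suc M) a zero _ = begin
      G 0 a * invGauss 0 0 + sumF R {M} (λ b → G (suc (toℕ b)) a * invGauss (suc (toℕ b)) 0)
        ≈⟨ +-congˡ (trans (sumF-cong {M} (λ b → trans (*-congˡ (invGauss-vanishes {suc (toℕ b)} (s≤s z≤n))) (zeroʳ _))) (∑-0 (Fin-summation M))) ⟩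
      G 0 a * invGauss 0 0 + 0#
        ≈⟨ +-identityʳ _ ⟩
      G 0 a * invGauss 0 0
        ≈⟨ *-congˡ (solve 0 ((:1 :* :1) :* (:1 :* :1) :* :1 := :1) refl) ⟩
      G 0 a * 1#
        ≈⟨ *-identityʳ _ ⟩
      G 0 a
        ≡⟨ gauss-zero a ⟩
      δ[ ℕ._≟_ ] a 0 ∎
      where
      gauss-zero : ∀ a → G 0 a ≡ δ[ ℕ._≟_ ] a 0
      gauss-zero zero    = ≡.refl
      gauss-zero (suc a) = ≡.refl
    ∑-gauss-invGauss (suc M) a (suc c) (s≤s c<M) = begin
      sumF R {suc M} (λ b → G (toℕ b) a * invGauss (toℕ b) (suc c))  ≈⟨ ∑-gauss-invGauss-suc M a c ⟩
      vᶜ * (ΣD a - pow R i M * G M a * invGauss M c)               ≈⟨ *-congˡ (+-congˡ (-‿cong (trans (*-congˡ (invGauss-vanishes c<M)) (zeroʳ _)))) ⟩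
      vᶜ * (ΣD a - 0#)                                             ≈⟨ *-congˡ (trans (+-congˡ -0#≈0#) (+-identityʳ _)) ⟩
      vᶜ * ΣD a                                                    ≈⟨ by-cases a ⟩
      δ[ ℕ._≟_ ] a (suc c)                                         ∎
      where
      open import Algebra.Properties.Ring ring using (-0#≈0#)
      vᶜ = pow R v c
      ΣD : ℕ → Carrier
      ΣD a = sumF R {M} (λ b → (pow R i (toℕ b) * G (suc (toℕ b)) a - pow R i (toℕ b) * G (toℕ b) a) * invGauss (toℕ b) c)
      by-cases : ∀ a → vᶜ * ΣD a ≈ δ[ ℕ._≟_ ] a (suc c)
      by-cases zero = begin
        vᶜ * ΣD 0     ≈⟨ *-congˡ (trans (sumF-cong {M} (λ b → trans (*-congʳ (-‿inverseʳ _)) (zeroˡ _))) (∑-0 (Fin-summation M))) ⟩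
        vᶜ * 0#       ≈⟨ zeroʳ _ ⟩
        0#            ∎
      by-cases (suc a) = begin
        vᶜ * ΣD (suc a)
          ≈⟨ *-congˡ (sumF-cong {M} (λ b → *-congʳ (gauss-difference (toℕ b) a))) ⟩
        vᶜ * sumF R {M} (λ b → (pow R i a * G (toℕ b) a) * invGauss (toℕ b) c)
          ≈⟨ *-congˡ (trans (sumF-cong {M} (λ b → *-assoc _ _ _)) (sumF-distribˡ-* {M} _ _)) ⟩
        vᶜ * (pow R i a * sumF R {M} (λ b → G (toℕ b) a * invGauss (toℕ b) c))
          ≈⟨ *-congˡ (*-congˡ (∑-gauss-invGauss M a c c<M)) ⟩
        vᶜ * (pow R i a * δ[ ℕ._≟_ ] a c)
          ≈⟨ solve 3 (λ x y d → x :* (y :* d) := d :* (x :* y)) refl _ _ _ ⟩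
        δ[ ℕ._≟_ ] a c * (vᶜ * pow R i a)
          ≈⟨ δ-subst ℕ._≟_ a c (λ x → vᶜ * pow R i x) ⟩
        δ[ ℕ._≟_ ] a c * (vᶜ * pow R i c)
          ≈⟨ trans (*-congˡ (ratio-refl q c)) (*-identityʳ _) ⟩
        δ[ ℕ._≟_ ] a c ∎

  -- Conjugation by the diagonal matrix κ turns this into ∑-gauss-invGauss for q⁻¹.
  ∑-invGauss-gauss : ∀ q M a c → c < M →
                     sumF R {M} (λ b → invGauss q a (toℕ b) * gauss R (val q) c (toℕ b)) ≈ δ[ ℕ._≟_ ] a c
  ∑-invGauss-gauss q M a c c<M = begin
    sumF R {M} (λ b → invGauss q a (toℕ b) * G c (toℕ b))              ≈⟨ sumF-cong {M} (λ b → conjugate (toℕ b)) ⟩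
    sumF R {M} (λ b → κ a * (G′ (toℕ b) a * invGauss q⁻¹ (toℕ b) c))   ≈⟨ sumF-distribˡ-* {M} (κ a) _ ⟩
    κ a * sumF R {M} (λ b → G′ (toℕ b) a * invGauss q⁻¹ (toℕ b) c)     ≈⟨ *-congˡ (∑-gauss-invGauss q⁻¹ M a c c<M) ⟩
    κ a * δ[ ℕ._≟_ ] a c                                              ≈⟨ *-comm _ _ ⟩
    δ[ ℕ._≟_ ] a c * κ a                                              ≈⟨ δ-subst ℕ._≟_ a c κ ⟩
    δ[ ℕ._≟_ ] a c * κ c                                              ≈⟨ *-congˡ κ-diagonal ⟩
    δ[ ℕ._≟_ ] a c * 1#                                               ≈⟨ *-identityʳ _ ⟩
    δ[ ℕ._≟_ ] a c                                                    ∎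
    where
    q⁻¹ = invU R q
    G G′ : ℕ → ℕ → Carrier
    G = gauss R (val q)
    G′ = gauss R (inv q)
    κ : ℕ → Carrier
    κ x = (σ x * σ c) * ratio q (x C 2) (c C 2)
    κ-diagonal : κ c ≈ 1#
    κ-diagonal = trans (*-cong (σ-involutive c) (ratio-refl q (c C 2))) (*-identityˡ 1#)
    conjugate : ∀ b → invGauss q a b * G c b ≈ κ a * (G′ b a * invGauss q⁻¹ b c)
    conjugate b = begin
      invGauss q a b * G c b                               ≈⟨ *-identityʳ _ ⟨
      (invGauss q a b * G c b) * 1#                        ≈⟨ *-congˡ κ-diagonal ⟨
      (invGauss q a b * G c b) * κ c
        ≈⟨ solve 9 (λ sa sb sc Vb Ia Vc Ic g g′ →
             ((sa :* sb) :* (Vb :* Ia) :* g) :* g′ :* ((sc :* sc) :* (Vc :* Ic))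
             := ((sa :* sc) :* (Vc :* Ia)) :* (g :* ((sb :* sc) :* (Ic :* Vb) :* g′)))
           refl (σ a) (σ b) (σ c) (pow R (val q) (b C 2)) (pow R (inv q) (a C 2))
                (pow R (val q) (c C 2)) (pow R (inv q) (c C 2)) (G′ b a) (G c b) ⟩
      κ a * (G′ b a * invGauss q⁻¹ b c)                    ∎

  module _ {N : ℕ} (q : UnitV R) where

    gaussMatrix invGaussMatrix : Fin N → Fin N → Carrier
    gaussMatrix a b = gauss R (val q) (toℕ b) (toℕ a)
    invGaussMatrix a b = invGauss q (toℕ a) (toℕ b)

    gauss-invGauss-rightInverse : IsRightInverseOf (Fin-summation N) invGaussMatrix gaussMatrix
    gauss-invGauss-rightInverse a c =
      trans (∑-gauss-invGauss q N (toℕ a) (toℕ c) (Fin.toℕ<n c)) (δ-injective Fin._≟_ ℕ._≟_ Fin.toℕ-injective a c)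

    invGauss-gauss-rightInverse : IsRightInverseOf (Fin-summation N) gaussMatrix invGaussMatrix
    invGauss-gauss-rightInverse a c =
      trans (∑-invGauss-gauss q N (toℕ a) (toℕ c) (Fin.toℕ<n c)) (δ-injective Fin._≟_ ℕ._≟_ Fin.toℕ-injective a c)

module RunningProducts {c ℓ} (R : CommutativeRing c ℓ) where
  open CommutativeRing R hiding (zero)
  open Kronecker R
  open FiniteSums R
  open import Algebra.Properties.CommutativeSemigroup *-commutativeSemigroup
    using () renaming (interchange to *-interchange)
  open import Relation.Binary.Reasoning.Setoid setoid

  Bit : Set
  Bit = Fin 2

  Bits-summation : ∀ n → Summation (Vec Bit n)
  Bits-summation = Vec-summation (Fin-summation 2)

  LocalFactor : Set (c ⊔ ℓ)
  LocalFactor = ℕ → ℕ → Bit → Bit → UnitV R → Carrier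

  -- ∏ᵢ F (s + Σ_{j<i} xⱼ) (t + Σ_{j<i} yⱼ) xᵢ yᵢ Yᵢ; for s = a₀ and t = b₀ the running
  -- sums are the paper's s_{i+1}(a) and s_{i+1}(b).
  runningProduct : ∀ {n} → LocalFactor → ℕ → ℕ → Vec Bit n → Vec Bit n → (Fin n → UnitV R) → Carrier
  runningProduct F s t []       []       Y = 1#
  runningProduct F s t (x ∷ xs) (y ∷ ys) Y =
    F s t x y (Y zero) * runningProduct F (s ℕ.+ toℕ x) (t ℕ.+ toℕ y) xs ys (Y ∘ suc)

  runningProduct-cong : ∀ {F F′ : LocalFactor} → (∀ s t x y q → F s t x y q ≈ F′ s t x y q) →
                        ∀ {n} s t (xs ys : Vec Bit n) Y → runningProduct F s t xs ys Y ≈ runningProduct F′ s t xs ys Y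
  runningProduct-cong F≈F′ s t []       []       Y = refl
  runningProduct-cong F≈F′ s t (x ∷ xs) (y ∷ ys) Y = *-cong (F≈F′ _ _ _ _ _) (runningProduct-cong F≈F′ _ _ xs ys _)

  runningProduct-* : ∀ (F F′ : LocalFactor) {n} s t (xs ys : Vec Bit n) Y →
                     runningProduct F s t xs ys Y * runningProduct F′ s t xs ys Y
                       ≈ runningProduct (λ s t x y q → F s t x y q * F′ s t x y q) s t xs ys Y
  runningProduct-* F F′ s t []       []       Y = *-identityˡ 1#
  runningProduct-* F F′ s t (x ∷ xs) (y ∷ ys) Y =
    trans (*-interchange _ _ _ _) (*-congˡ (runningProduct-* F F′ _ _ xs ys _))

  runningProduct-∘ : ∀ (F : LocalFactor) (f : UnitV R → UnitV R) {n} s t (xs ys : Vec Bit n) Y →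
                     runningProduct F s t xs ys (f ∘ Y) ≈ runningProduct (λ s t x y → F s t x y ∘ f) s t xs ys Y
  runningProduct-∘ F f s t []       []       Y = refl
  runningProduct-∘ F f s t (x ∷ xs) (y ∷ ys) Y = *-congˡ (runningProduct-∘ F f _ _ xs ys (Y ∘ suc))

  prefixSum : ∀ {n} → ℕ → Vec Bit n → ℕ → ℕ
  prefixSum s xs k = s ℕ.+ ℕ.sum (take k (toList (Vec.map toℕ xs)))

  prodF-runningProduct : ∀ (F : LocalFactor) {n} s t (xs ys : Vec Bit n) Y →
    prodF R (λ i → F (prefixSum s xs (toℕ i)) (prefixSum t ys (toℕ i)) (lookup xs i) (lookup ys i) (Y i))
      ≈ runningProduct F s t xs ys Y
  prodF-runningProduct F s t []       []       Y = refl
  prodF-runningProduct F s t (x ∷ xs) (y ∷ ys) Y = *-cong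
    (reflexive (≡.cong₂ (λ s′ t′ → F s′ t′ x y (Y zero)) (ℕ.+-identityʳ s) (ℕ.+-identityʳ t)))
    (trans (prodF-cong (λ i → reflexive (≡.cong₂ (λ s′ t′ → F s′ t′ (lookup xs i) (lookup ys i) (Y (suc i)))
                                          (≡.sym (ℕ.+-assoc s (toℕ x) _)) (≡.sym (ℕ.+-assoc t (toℕ y) _)))))
           (prodF-runningProduct F (s ℕ.+ toℕ x) (t ℕ.+ toℕ y) xs ys (Y ∘ suc)))
    where
    prodF-cong : ∀ {m} {f g : Fin m → Carrier} → (∀ i → f i ≈ g i) → prodF R f ≈ prodF R g
    prodF-cong {zero}  f≈g = refl
    prodF-cong {suc m} f≈g = *-cong (f≈g zero) (prodF-cong (f≈g ∘ suc))

  ∑-runningProduct : ∀ {F₁ F₂ K : LocalFactor} →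
    (∀ s t u x z q → sumF R (λ y → F₁ s t x y q * F₂ t u y z q) ≈ K s u x z q) →
    ∀ {n} s t u (xs zs : Vec Bit n) Y →
    ∑ (Bits-summation n) (λ ys → runningProduct F₁ s t xs ys Y * runningProduct F₂ t u ys zs Y) ≈ runningProduct K s u xs zs Y
  ∑-runningProduct compose s t u []       []       Y = *-identityˡ 1#
  ∑-runningProduct {F₁} {F₂} {K} compose {suc n} s t u (x ∷ xs) (z ∷ zs) Y = begin
    sumF R (λ y → ∑ (Bits-summation n) (λ ys → (F₁ s t x y q * P₁ y ys) * (F₂ t u y z q * P₂ y ys)))
      ≈⟨ sumF-cong {2} (λ y → trans (∑-cong (Bits-summation n) (λ ys → *-interchange (F₁ s t x y q) (P₁ y ys) (F₂ t u y z q) (P₂ y ys)))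
                                     (∑-distribˡ-* (Bits-summation n) (Q y) (λ ys → P₁ y ys * P₂ y ys))) ⟩
    sumF R (λ y → Q y * ∑ (Bits-summation n) (λ ys → P₁ y ys * P₂ y ys))
      ≈⟨ sumF-cong {2} (λ y → *-congˡ {Q y} (∑-runningProduct {F₁} {F₂} {K} compose (s ℕ.+ toℕ x) (t ℕ.+ toℕ y) (u ℕ.+ toℕ z) xs zs (Y ∘ suc))) ⟩
    sumF R (λ y → Q y * P)
      ≈⟨ ∑-distribʳ-* (Fin-summation 2) P Q ⟩
    sumF R Q * P
      ≈⟨ *-congʳ (compose s t u x z q) ⟩
    K s u x z q * P ∎
    where
    q = Y zero
    Q : Bit → Carrier
    Q y = F₁ s t x y q * F₂ t u y z q
    P₁ P₂ : Bit → Vec Bit n → Carrier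
    P₁ y ys = runningProduct F₁ (s ℕ.+ toℕ x) (t ℕ.+ toℕ y) xs ys (Y ∘ suc)
    P₂ y ys = runningProduct F₂ (t ℕ.+ toℕ y) (u ℕ.+ toℕ z) ys zs (Y ∘ suc)
    P : Carrier
    P = runningProduct K (s ℕ.+ toℕ x) (u ℕ.+ toℕ z) xs zs (Y ∘ suc)

  runningProduct-diagonal : ∀ {K : LocalFactor} → (∀ s x z q → K s s x z q ≈ δ[ Fin._≟_ ] x z) →
    ∀ {n} s (xs zs : Vec Bit n) Y → runningProduct K s s xs zs Y ≈ δ (Bits-summation n) xs zs
  runningProduct-diagonal K≈δ s []       []       Y = refl
  runningProduct-diagonal {K} K≈δ {suc n} s (x ∷ xs) (z ∷ zs) Y = begin
    K s s x z (Y zero) * P z                               ≈⟨ *-congʳ (K≈δ s x z (Y zero)) ⟩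
    δ[ Fin._≟_ ] x z * P z                                 ≈⟨ δ-subst Fin._≟_ x z P ⟨
    δ[ Fin._≟_ ] x z * P x                                 ≈⟨ *-congˡ (runningProduct-diagonal K≈δ _ xs zs (Y ∘ suc)) ⟩
    δ[ Fin._≟_ ] x z * δ (Bits-summation n) xs zs
      ≈⟨ δ-× Fin._≟_ (_≟_ (Bits-summation n)) (_≟_ (×-summation (Fin-summation 2) (Bits-summation n))) x z xs zs ⟨
    δ (Bits-summation (suc n)) (x ∷ xs) (z ∷ zs)           ∎
    where
    P : Bit → Carrier
    P w = runningProduct K (s ℕ.+ toℕ x) (s ℕ.+ toℕ w) xs zs (Y ∘ suc)

module NormalForms {c ℓ} (R : CommutativeRing c ℓ) where
  open import Data.Product using (_×_)
  open CommutativeRing R hiding (zero)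
  open IntegerCoefficients R using (solve; _:=_; _:+_; _:*_; _:-_; :-_; :0; :1; :-1)
  open Kronecker R
  open Powers R
  open GaussianInversion R
  open RunningProducts R
  open import Algebra.Properties.CommutativeSemigroup *-commutativeSemigroup
    using () renaming (interchange to *-interchange)
  open import Relation.Binary.Reasoning.Setoid setoid

  -- The factors at one position of φ (wLocal) and of m₁ (mLocal, which absorbs that
  -- position's share of the sign and of ∏ Y^Δ), in terms of the running sums s, t and
  -- the bits x = aᵢ, y = bᵢ. Their products wmLocal and mwLocal do not depend on the
  -- middle running sum because ratio is multiplicative (ratio-trans).
  wLocal mLocal wmLocal mwLocal : LocalFactor
  wLocal s t zero          y             q = 1#
  wLocal s t (suc zero)    zero          q = 1# - ratio q s t
  wLocal s t (suc zero)    (suc zero)    q = 1#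

  mLocal s t zero          zero          q = ratio q s t
  mLocal s t zero          (suc zero)    q = - ratio q s t
  mLocal s t (suc zero)    zero          q = 1# - ratio q s t
  mLocal s t (suc zero)    (suc zero)    q = ratio q s t

  wmLocal s u zero         zero          q = 1#
  wmLocal s u zero         (suc zero)    q = 0#
  wmLocal s u (suc zero)   zero          q = 1# - ratio q s u
  wmLocal s u (suc zero)   (suc zero)    q = ratio q s u

  mwLocal s u zero         zero          q = ratio q s u
  mwLocal s u zero         (suc zero)    q = 0#
  mwLocal s u (suc zero)   zero          q = 1# - ratio q s u
  mwLocal s u (suc zero)   (suc zero)    q = 1#

  wLocal-mLocal : ∀ s t u x z q → sumF R (λ y → wLocal s t x y q * mLocal t u y z q) ≈ wmLocal s u x z q
  wLocal-mLocal s t u zero       zero       q =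
    solve 1 (λ r → :1 :* r :+ (:1 :* (:1 :- r) :+ :0) := :1) refl (ratio q t u)
  wLocal-mLocal s t u zero       (suc zero) q =
    solve 1 (λ r → :1 :* (:- r) :+ (:1 :* r :+ :0) := :0) refl (ratio q t u)
  wLocal-mLocal s t u (suc zero) zero       q = trans
    (solve 2 (λ r r′ → (:1 :- r) :* r′ :+ (:1 :* (:1 :- r′) :+ :0) := :1 :- r :* r′) refl (ratio q s t) (ratio q t u))
    (+-congˡ (-‿cong (ratio-trans q s t u)))
  wLocal-mLocal s t u (suc zero) (suc zero) q = trans
    (solve 2 (λ r r′ → (:1 :- r) :* (:- r′) :+ (:1 :* r′ :+ :0) := r :* r′) refl (ratio q s t) (ratio q t u))
    (ratio-trans q s t u)

  mLocal-wLocal : ∀ s t u x z q → sumF R (λ y → mLocal s t x y q * wLocal t u y z q) ≈ mwLocal s u x z q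
  mLocal-wLocal s t u zero       zero       q = trans
    (solve 2 (λ r r′ → r :* :1 :+ ((:- r) :* (:1 :- r′) :+ :0) := r :* r′) refl (ratio q s t) (ratio q t u))
    (ratio-trans q s t u)
  mLocal-wLocal s t u zero       (suc zero) q =
    solve 1 (λ r → r :* :1 :+ ((:- r) :* :1 :+ :0) := :0) refl (ratio q s t)
  mLocal-wLocal s t u (suc zero) zero       q = trans
    (solve 2 (λ r r′ → (:1 :- r) :* :1 :+ (r :* (:1 :- r′) :+ :0) := :1 :- r :* r′) refl (ratio q s t) (ratio q t u))
    (+-congˡ (-‿cong (ratio-trans q s t u)))
  mLocal-wLocal s t u (suc zero) (suc zero) q =
    solve 1 (λ r → (:1 :- r) :* :1 :+ (r :* :1 :+ :0) := :1) refl (ratio q s t)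

  private
    1-ratio-refl : ∀ q s → 1# - ratio q s s ≈ 0#
    1-ratio-refl q s = trans (+-congˡ (-‿cong (ratio-refl q s))) (-‿inverseʳ 1#)

  wmLocal-diagonal : ∀ s x z q → wmLocal s s x z q ≈ δ[ Fin._≟_ ] x z
  wmLocal-diagonal s zero       zero       q = refl
  wmLocal-diagonal s zero       (suc zero) q = refl
  wmLocal-diagonal s (suc zero) zero       q = 1-ratio-refl q s
  wmLocal-diagonal s (suc zero) (suc zero) q = ratio-refl q s

  mwLocal-diagonal : ∀ s x z q → mwLocal s s x z q ≈ δ[ Fin._≟_ ] x z
  mwLocal-diagonal s zero       zero       q = ratio-refl q s
  mwLocal-diagonal s zero       (suc zero) q = refl
  mwLocal-diagonal s (suc zero) zero       q = 1-ratio-refl q s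
  mwLocal-diagonal s (suc zero) (suc zero) q = refl

  private
    all-upTo-suc : ∀ (p : ℕ → Bool) n → all p (upTo (suc n)) ≡ p 0 ∧ all (p ∘ suc) (upTo n)
    all-upTo-suc p n = ≡.cong (λ b → p 0 ∧ and b)
      (≡.trans (List.map-applyUpTo suc p n) (≡.sym (List.map-applyUpTo id (p ∘ suc) n)))

    all-cong : ∀ {p p′ : ℕ → Bool} → (∀ i → p i ≡ p′ i) → ∀ xs → all p xs ≡ all p′ xs
    all-cong p≗p′ xs = ≡.cong and (List.map-cong p≗p′ xs)

    wLocal-vanishes : ∀ {s t} x y q → s ≤ t → t ℕ.+ toℕ y < s ℕ.+ toℕ x → wLocal s t x y q ≈ 0#
    wLocal-vanishes {s} {t} zero       y          q s≤t t+y<s+0 =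
      ⊥-elim (ℕ.<⇒≱ t+y<s+0 (ℕ.≤-trans (ℕ.≤-reflexive (ℕ.+-identityʳ s)) (ℕ.≤-trans s≤t (ℕ.m≤m+n t (toℕ y)))))
    wLocal-vanishes {s} {t} (suc zero) (suc zero) q s≤t t+1<s+1 =
      ⊥-elim (ℕ.<⇒≱ t+1<s+1 (ℕ.+-monoˡ-≤ 1 s≤t))
    wLocal-vanishes {s} {t} (suc zero) zero       q s≤t t<s+1 = begin
      1# - ratio q s t    ≡⟨ ≡.cong (λ u → 1# - ratio q s u) (ℕ.≤-antisym s≤t (ℕ.≤-pred t<1+s)) ⟨
      1# - ratio q s s    ≈⟨ 1-ratio-refl q s ⟩
      0#                  ∎
      where
      t<1+s : t < suc s
      t<1+s = ≡.subst₂ _<_ (ℕ.+-identityʳ t) (ℕ.+-comm s 1) t<s+1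

    ∧≡false : ∀ a {b} → a ∧ b ≡ false → a ≡ false ⊎ (a ≡ true × b ≡ false)
    ∧≡false false _  = inj₁ ≡.refl
    ∧≡false true  eq = inj₂ (≡.refl , eq)

  dominance : ∀ {n} → ℕ → ℕ → Vec Bit n → Vec Bit n → ℕ → Bool
  dominance s t xs ys i = prefixSum s xs i ≤ᵇ prefixSum t ys i

  dominance-∷ : ∀ {n} s t x y (xs ys : Vec Bit n) i →
                dominance s t (x ∷ xs) (y ∷ ys) (suc i) ≡ dominance (s ℕ.+ toℕ x) (t ℕ.+ toℕ y) xs ys i
  dominance-∷ s t x y xs ys i = ≡.cong₂ _≤ᵇ_ (≡.sym (ℕ.+-assoc s (toℕ x) _)) (≡.sym (ℕ.+-assoc t (toℕ y) _))

  -- If the running sums of a overtake those of b, then b₀ < a₀ or, at the first crossing,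
  -- aᵢ = 1 and bᵢ = 0 with equal running sums, giving the factor 1 - q⁰ = 0. So the test
  -- a ≤ₜ b in φ is redundant.
  undominated-vanishes : ∀ {n} s t (xs ys : Vec Bit n) Y → all (dominance s t xs ys) (upTo (suc n)) ≡ false →
                         t < s ⊎ runningProduct wLocal s t xs ys Y ≈ 0#
  undominated-vanishes {n} s t xs ys Y undominated
    with ∧≡false (dominance s t xs ys 0) (≡.trans (≡.sym (all-upTo-suc (dominance s t xs ys) n)) undominated)
  ... | inj₁ s≰ᵇt = inj₁ (ℕ.≰⇒> (λ s≤t → ≡.subst T s≰ᵇt (ℕ.≤⇒≤ᵇ (ℕ.+-monoˡ-≤ 0 s≤t))))
  ... | inj₂ (s≤ᵇt , rest) = inj₂ (vanishes xs ys Y rest)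
    where
    s≤t : s ≤ t
    s≤t = ≡.subst₂ _≤_ (ℕ.+-identityʳ s) (ℕ.+-identityʳ t) (ℕ.≤ᵇ⇒≤ _ _ (≡.subst T (≡.sym s≤ᵇt) _))
    vanishes : ∀ {n} (xs ys : Vec Bit n) Y → all (dominance s t xs ys ∘ suc) (upTo n) ≡ false →
               runningProduct wLocal s t xs ys Y ≈ 0#
    vanishes [] [] Y ()
    vanishes {suc n} (x ∷ xs) (y ∷ ys) Y rest
      with undominated-vanishes (s ℕ.+ toℕ x) (t ℕ.+ toℕ y) xs ys (Y ∘ suc)
             (≡.trans (≡.sym (all-cong (dominance-∷ s t x y xs ys) (upTo (suc n)))) rest)
    ... | inj₁ crossed = trans (*-congʳ (wLocal-vanishes x y (Y zero) s≤t crossed)) (zeroˡ _)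
    ... | inj₂ tail≈0  = trans (*-congˡ tail≈0) (zeroʳ _)

  private
    φLocal : LocalFactor
    φLocal s t x y q = if isOne R x ∧ isZero R y then 1# - ipow R q (+ t ℤ.- + s) else 1#

    φLocal≈wLocal : ∀ s t x y q → φLocal s t x y q ≈ wLocal s t x y q
    φLocal≈wLocal s t zero       zero       q = refl
    φLocal≈wLocal s t zero       (suc zero) q = refl
    φLocal≈wLocal s t (suc zero) zero       q = +-congˡ (-‿cong (ipow-ratio q s t))
    φLocal≈wLocal s t (suc zero) (suc zero) q = refl

  w1-normal : ∀ {n r} (a₀ b₀ : Fin (suc r)) (xs ys : Vec Bit n) Y →
              w1 R (a₀ , xs) (b₀ , ys) Y
                ≈ gauss R (val (Y zero)) (toℕ b₀) (toℕ a₀) * runningProduct wLocal (toℕ a₀) (toℕ b₀) xs ys (Y ∘ suc)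
  w1-normal a₀ b₀ xs ys Y with leqt (a₀ , xs) (b₀ , ys) in dominated
  ... | true  = *-congˡ (trans (prodF-runningProduct φLocal (toℕ a₀) (toℕ b₀) xs ys (Y ∘ suc))
                               (runningProduct-cong φLocal≈wLocal (toℕ a₀) (toℕ b₀) xs ys (Y ∘ suc)))
  ... | false with undominated-vanishes (toℕ a₀) (toℕ b₀) xs ys (Y ∘ suc) dominated
  ...   | inj₁ b₀<a₀ = trans (zeroʳ _) (sym (trans (*-congʳ (gauss-vanishes (val (Y zero)) b₀<a₀)) (zeroˡ _)))
  ...   | inj₂ P≈0   = *-congˡ (sym P≈0)

  private
    sgn≈ipow : ∀ d → sgn R d ≈ ipow R -1ᵘ d
    sgn≈ipow (+ k)     = refl
    sgn≈ipow -[1+ k ]  = refl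

    ratioLocal signLocal : LocalFactor
    ratioLocal s t x y q = ratio q s t
    signLocal s t x y q = σ (toℕ x) * σ (toℕ y)

    σ-sums : ∀ {n} s t (xs ys : Vec Bit n) Y →
             σ (ℕ.sum (take n (toList (Vec.map toℕ xs)))) * σ (ℕ.sum (take n (toList (Vec.map toℕ ys))))
               ≈ runningProduct signLocal s t xs ys Y
    σ-sums s t []       []       Y = *-identityˡ 1#
    σ-sums {suc n} s t (x ∷ xs) (y ∷ ys) Y = begin
      σ (toℕ x ℕ.+ Σxs) * σ (toℕ y ℕ.+ Σys)          ≈⟨ *-cong (pow-+ (- 1#) (toℕ x) Σxs) (pow-+ (- 1#) (toℕ y) Σys) ⟩
      (σ (toℕ x) * σ Σxs) * (σ (toℕ y) * σ Σys)      ≈⟨ *-interchange _ _ _ _ ⟩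
      (σ (toℕ x) * σ (toℕ y)) * (σ Σxs * σ Σys)      ≈⟨ *-congˡ (σ-sums _ _ xs ys (Y ∘ suc)) ⟩
      (σ (toℕ x) * σ (toℕ y)) * runningProduct signLocal _ _ xs ys (Y ∘ suc) ∎
      where
      Σxs = ℕ.sum (take n (toList (Vec.map toℕ xs)))
      Σys = ℕ.sum (take n (toList (Vec.map toℕ ys)))

    mLocal-factorisation : ∀ s t x y q → (signLocal s t x y q * ratioLocal s t x y q) * wLocal s t x y (invU R q) ≈ mLocal s t x y q
    mLocal-factorisation s t zero       zero       q = solve 1 (λ r → ((:1 :* :1) :* r) :* :1 := r) refl (ratio q s t)
    mLocal-factorisation s t zero       (suc zero) q = solve 1 (λ r → ((:1 :* (:-1 :* :1)) :* r) :* :1 := :- r) refl (ratio q s t)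
    mLocal-factorisation s t (suc zero) (suc zero) q = solve 1 (λ r → (((:-1 :* :1) :* (:-1 :* :1)) :* r) :* :1 := r) refl (ratio q s t)
    mLocal-factorisation s t (suc zero) zero       q = begin
      (((- 1# * 1#) * 1#) * (vᵗ * iˢ)) * (1# - iᵗ * vˢ)
        ≈⟨ solve 4 (λ vᵗ iˢ iᵗ vˢ → (((:-1 :* :1) :* :1) :* (vᵗ :* iˢ)) :* (:1 :- iᵗ :* vˢ)
                                    := (:1 :- vᵗ :* iˢ) :+ ((vᵗ :* iᵗ) :* (vˢ :* iˢ) :- :1)) refl vᵗ iˢ iᵗ vˢ ⟩
      (1# - vᵗ * iˢ) + ((vᵗ * iᵗ) * (vˢ * iˢ) - 1#)
        ≈⟨ +-congˡ (+-congʳ (*-cong (ratio-refl q t) (ratio-refl q s))) ⟩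
      (1# - vᵗ * iˢ) + (1# * 1# - 1#)
        ≈⟨ solve 1 (λ r → (:1 :- r) :+ (:1 :* :1 :- :1) := :1 :- r) refl (vᵗ * iˢ) ⟩
      1# - vᵗ * iˢ ∎
      where
      vᵗ = pow R (val q) t
      vˢ = pow R (val q) s
      iᵗ = pow R (inv q) t
      iˢ = pow R (inv q) s

  m1-normal : ∀ {n r} (a₀ b₀ : Fin (suc r)) (xs ys : Vec Bit n) Y →
              m1 R (a₀ , xs) (b₀ , ys) Y
                ≈ invGauss (Y zero) (toℕ a₀) (toℕ b₀) * runningProduct mLocal (toℕ a₀) (toℕ b₀) xs ys (Y ∘ suc)
  m1-normal {n} a₀ b₀ xs ys Y = begin
    (sgn R (+ prefixSum b ys n ℤ.- + prefixSum a xs n)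
      * (ipow R q (+ (b C 2) ℤ.- + (a C 2)) * prodF R (λ i → ipow R (Y′ i) (+ prefixSum b ys (toℕ i) ℤ.- + prefixSum a xs (toℕ i)))))
      * w1 R (a₀ , xs) (b₀ , ys) (invU R ∘ Y)
      ≈⟨ *-cong (*-cong sign (*-cong (ipow-ratio q (a C 2) (b C 2)) ratios))
                (trans (w1-normal a₀ b₀ xs ys (invU R ∘ Y)) (*-congˡ (runningProduct-∘ wLocal (invU R) a b xs ys Y′))) ⟩
    (σ (b ℕ.+ Σys) * σ (a ℕ.+ Σxs) * (ratio q (a C 2) (b C 2) * P ratioLocal)) * (gauss R (inv q) b a * P wLocal⁻¹)
      ≈⟨ *-congʳ (*-congʳ (*-cong (pow-+ (- 1#) b Σys) (pow-+ (- 1#) a Σxs))) ⟩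
    ((σ b * σ Σys) * (σ a * σ Σxs) * (ratio q (a C 2) (b C 2) * P ratioLocal)) * (gauss R (inv q) b a * P wLocal⁻¹)
      ≈⟨ solve 8 (λ σb σΣys σa σΣxs ρ P₁ g P₂ →
           ((σb :* σΣys) :* (σa :* σΣxs) :* (ρ :* P₁)) :* (g :* P₂)
           := ((σa :* σb) :* ρ :* g) :* (((σΣxs :* σΣys) :* P₁) :* P₂))
         refl (σ b) (σ Σys) (σ a) (σ Σxs) (ratio q (a C 2) (b C 2)) (P ratioLocal) (gauss R (inv q) b a) (P wLocal⁻¹) ⟩
    invGauss q a b * (((σ Σxs * σ Σys) * P ratioLocal) * P wLocal⁻¹)
      ≈⟨ *-congˡ (*-congʳ (*-congʳ (σ-sums a b xs ys Y′))) ⟩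
    invGauss q a b * ((P signLocal * P ratioLocal) * P wLocal⁻¹)
      ≈⟨ *-congˡ (trans (*-congʳ (runningProduct-* signLocal ratioLocal a b xs ys Y′)) (runningProduct-* _ wLocal⁻¹ a b xs ys Y′)) ⟩
    invGauss q a b * runningProduct (λ s t x y q → (signLocal s t x y q * ratioLocal s t x y q) * wLocal⁻¹ s t x y q) a b xs ys Y′
      ≈⟨ *-congˡ (runningProduct-cong mLocal-factorisation a b xs ys Y′) ⟩
    invGauss q a b * P mLocal ∎
    where
    q = Y zero
    Y′ = Y ∘ suc
    a = toℕ a₀
    b = toℕ b₀
    Σxs = ℕ.sum (take n (toList (Vec.map toℕ xs)))
    Σys = ℕ.sum (take n (toList (Vec.map toℕ ys)))
    P : LocalFactor → Carrier
    P F = runningProduct F a b xs ys Y′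
    wLocal⁻¹ : LocalFactor
    wLocal⁻¹ s t x y = wLocal s t x y ∘ invU R
    sign : sgn R (+ (b ℕ.+ Σys) ℤ.- + (a ℕ.+ Σxs)) ≈ σ (b ℕ.+ Σys) * σ (a ℕ.+ Σxs)
    sign = trans (sgn≈ipow (+ (b ℕ.+ Σys) ℤ.- + (a ℕ.+ Σxs))) (ipow-ratio -1ᵘ (a ℕ.+ Σxs) (b ℕ.+ Σys))
    ratios : prodF R (λ i → ipow R (Y′ i) (+ prefixSum b ys (toℕ i) ℤ.- + prefixSum a xs (toℕ i))) ≈ P ratioLocal
    ratios = trans (prodF-runningProduct (λ s t x y q → ipow R q (+ t ℤ.- + s)) a b xs ys Y′)
                   (runningProduct-cong (λ s t x y q → ipow-ratio q s t) a b xs ys Y′)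

module MatrixInverse {c ℓ} (R : CommutativeRing c ℓ) where
  open CommutativeRing R hiding (zero)
  open Kronecker R
  open FiniteSums R
  open GaussianInversion R
  open RunningProducts R
  open NormalForms R
  open import Algebra.Properties.CommutativeSemigroup *-commutativeSemigroup
    using () renaming (interchange to *-interchange)
  open import Relation.Binary.Reasoning.Setoid setoid

  Pnr-summation : ∀ n r → Summation (Pnr n r)
  Pnr-summation n r = ×-summation (Fin-summation (suc r)) (Bits-summation n)

  PP-summation : ∀ g (ns rs : Vec ℕ g) → Summation (PP g ns rs)
  PP-summation zero    []       []       = ⊤-summation
  PP-summation (suc g) (n ∷ ns) (r ∷ rs) = ×-summation (Pnr-summation n r) (PP-summation g ns rs)

  Pnr-kernel : ∀ {n r} → (Fin (suc r) → Fin (suc r) → Carrier) → LocalFactor → (Fin n → UnitV R) →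
               Pnr n r → Pnr n r → Carrier
  Pnr-kernel P F Y (a₀ , xs) (b₀ , ys) = P a₀ b₀ * runningProduct F (toℕ a₀) (toℕ b₀) xs ys Y

  Pnr-kernel-rightInverse : ∀ {n r} {P Q : Fin (suc r) → Fin (suc r) → Carrier} {F₁ F₂ K : LocalFactor} →
    IsRightInverseOf (Fin-summation (suc r)) Q P →
    (∀ s t u x z q → sumF R (λ y → F₁ s t x y q * F₂ t u y z q) ≈ K s u x z q) →
    (∀ s x z q → K s s x z q ≈ δ[ Fin._≟_ ] x z) →
    (Y : Fin n → UnitV R) → IsRightInverseOf (Pnr-summation n r) (Pnr-kernel Q F₂ Y) (Pnr-kernel P F₁ Y)
  Pnr-kernel-rightInverse {n} {r} {P} {Q} {F₁} {F₂} {K} PQ≈δ compose K≈δ Y (a₀ , xs) (c₀ , zs) = begin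
    sumF R (λ b₀ → ∑ (Bits-summation n) (λ ys → (P a₀ b₀ * P₁ b₀ ys) * (Q b₀ c₀ * P₂ b₀ ys)))
      ≈⟨ sumF-cong {suc r} (λ b₀ → trans (∑-cong (Bits-summation n) (λ ys → *-interchange (P a₀ b₀) (P₁ b₀ ys) (Q b₀ c₀) (P₂ b₀ ys)))
                                         (∑-distribˡ-* (Bits-summation n) (P a₀ b₀ * Q b₀ c₀) (λ ys → P₁ b₀ ys * P₂ b₀ ys))) ⟩
    sumF R (λ b₀ → (P a₀ b₀ * Q b₀ c₀) * ∑ (Bits-summation n) (λ ys → P₁ b₀ ys * P₂ b₀ ys))
      ≈⟨ sumF-cong {suc r} (λ b₀ → *-congˡ {P a₀ b₀ * Q b₀ c₀} (∑-runningProduct {F₁} {F₂} {K} compose (toℕ a₀) (toℕ b₀) (toℕ c₀) xs zs Y)) ⟩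
    sumF R (λ b₀ → (P a₀ b₀ * Q b₀ c₀) * H a₀)
      ≈⟨ ∑-distribʳ-* (Fin-summation (suc r)) (H a₀) (λ b₀ → P a₀ b₀ * Q b₀ c₀) ⟩
    sumF R (λ b₀ → P a₀ b₀ * Q b₀ c₀) * H a₀
      ≈⟨ *-congʳ (PQ≈δ a₀ c₀) ⟩
    δ[ Fin._≟_ ] a₀ c₀ * H a₀
      ≈⟨ δ-subst Fin._≟_ a₀ c₀ H ⟩
    δ[ Fin._≟_ ] a₀ c₀ * H c₀
      ≈⟨ *-congˡ (runningProduct-diagonal K≈δ (toℕ c₀) xs zs Y) ⟩
    δ[ Fin._≟_ ] a₀ c₀ * δ (Bits-summation n) xs zs
      ≈⟨ δ-× Fin._≟_ (_≟_ (Bits-summation n)) (_≟_ (Pnr-summation n r)) a₀ c₀ xs zs ⟨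
    δ (Pnr-summation n r) (a₀ , xs) (c₀ , zs) ∎
    where
    P₁ P₂ : Fin (suc r) → Vec Bit n → Carrier
    P₁ b₀ ys = runningProduct F₁ (toℕ a₀) (toℕ b₀) xs ys Y
    P₂ b₀ ys = runningProduct F₂ (toℕ b₀) (toℕ c₀) ys zs Y
    H : Fin (suc r) → Carrier
    H a = runningProduct K (toℕ a) (toℕ c₀) xs zs Y

  module _ {n r : ℕ} (Y : Fin (suc n) → UnitV R) where

    w1-m1-rightInverse : IsRightInverseOf (Pnr-summation n r) (λ a b → m1 R a b Y) (λ a b → w1 R a b Y)
    w1-m1-rightInverse = IsRightInverseOf-resp (Pnr-summation n r)
      (λ a b → sym (w1-normal (proj₁ a) (proj₁ b) (proj₂ a) (proj₂ b) Y))
      (λ a b → sym (m1-normal (proj₁ a) (proj₁ b) (proj₂ a) (proj₂ b) Y))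
      (Pnr-kernel-rightInverse {P = gaussMatrix (Y zero)} {invGaussMatrix (Y zero)}
        (gauss-invGauss-rightInverse (Y zero)) wLocal-mLocal wmLocal-diagonal (Y ∘ suc))

    m1-w1-rightInverse : IsRightInverseOf (Pnr-summation n r) (λ a b → w1 R a b Y) (λ a b → m1 R a b Y)
    m1-w1-rightInverse = IsRightInverseOf-resp (Pnr-summation n r)
      (λ a b → sym (m1-normal (proj₁ a) (proj₁ b) (proj₂ a) (proj₂ b) Y))
      (λ a b → sym (w1-normal (proj₁ a) (proj₁ b) (proj₂ a) (proj₂ b) Y))
      (Pnr-kernel-rightInverse {P = invGaussMatrix (Y zero)} {gaussMatrix (Y zero)}
        (invGauss-gauss-rightInverse (Y zero)) mLocal-wLocal mwLocal-diagonal (Y ∘ suc))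

  w-m-rightInverse : ∀ {g ns rs} (Y : Vars R g ns) → IsRightInverseOf (PP-summation g ns rs) (m R Y) (w R Y)
  w-m-rightInverse {zero}  {[]}     {[]}     Y _ _ = *-identityˡ 1#
  w-m-rightInverse {suc g} {n ∷ ns} {r ∷ rs} Y =
    ⊗-rightInverse (Pnr-summation n r) (PP-summation g ns rs) {λ a b → w1 R a b (Y zero)} {λ a b → m1 R a b (Y zero)}
      (w1-m1-rightInverse (Y zero)) (w-m-rightInverse (Y ∘ suc))

  m-w-rightInverse : ∀ {g ns rs} (Y : Vars R g ns) → IsRightInverseOf (PP-summation g ns rs) (w R Y) (m R Y)
  m-w-rightInverse {zero}  {[]}     {[]}     Y _ _ = *-identityˡ 1#
  m-w-rightInverse {suc g} {n ∷ ns} {r ∷ rs} Y =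
    ⊗-rightInverse (Pnr-summation n r) (PP-summation g ns rs) {λ a b → m1 R a b (Y zero)} {λ a b → w1 R a b (Y zero)}
      (m1-w1-rightInverse (Y zero)) (m-w-rightInverse (Y ∘ suc))

lemma5p4 : ∀ {c ℓ} (R : CommutativeRing c ℓ) (g : ℕ) → 1 ≤ g → (ns rs : Vec ℕ g)
    → (e : Fin (size ns rs) ↔ PP g ns rs) → (Y : Vars R g ns)
    → IsInverseOf R (Mmat R e Y) (Zmat R e Y)
lemma5p4 R g _ ns rs e Y =
    reindex-rightInverse (PP-summation g ns rs) e (w-m-rightInverse Y)
  , reindex-rightInverse (PP-summation g ns rs) e (m-w-rightInverse Y)
  where
  open FiniteSums R
  open MatrixInverse R
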